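{- Let $G$ be a graph without isolated vertices, $B$ a $\wedge_d$-OBDD representing $\psi(G)$ and obeying a linear order $\pi^*$ of $V(G^*)$. Let $U=\{u_1,\dots,u_q\}$, $W=\{w_1,\dots,w_q\}\subseteq V(G)$ be such that $M=\{\{u_i[1],w_i[2]\}:1\le i\le q\}$ is an induced matching of $G^*$ and every element of $U[1]$ precedes every element of $W[2]$ in $\pi^*$. Let $\pi_0$ be the prefix of $\pi^*$ ending with the last element of $U[1]$ and let $\mathcal{F}$, $I({\bf g})$, $L({\bf g})$ be as defined in the context. Then for every ${\bf g}\in\mathcal{F}$ there is $u\in L({\bf g})$ such that $W[2]_{I({\bf g})}\subseteq\mathsf{var}(B_u)$.
   Context: $G^*$ has vertex set $V[1]\cup V[2]$ ($V[i]=\{v[i]:v\in V(G)\}$ disjoint copies of $V(G)$) and edges $\{u[1],v[2]\}$, $\{v[1],u[2]\}$ for each $\{u,v\}\in E(G)$; $U[i]=\{u[i]:u\in U\}$. $\psi(G)$ is the CNF on $V(G^*)$ with clause $(a\vee b)$ per edge $\{a,b\}$ of $G^*$ plus clauses $\bigvee_{v}\neg v[1]$ and $\bigvee_v\neg v[2]$. A matching is induced if there is no edge between endpoints of distinct matching edges. A $\wedge_d$-FBDD is a DAG $B$ with one source, sinks ${\bf 0},{\bf 1}$, decision nodes labelled by variables with out-edges labelled $0,1$, and conjunction nodes with two children; for a node $u$, $B_u$ is the sub-DAG reachable from $u$ and $\mathsf{var}(B_u)$ the set of labels of its decision nodes; the variable sets below the two children of each conjunction node are disjoint and no path repeats a variable.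 Accepted assignments (maps to $\{0,1\}$ as sets of pairs): $\{\emptyset\}$ at ${\bf 1}$, $\emptyset$ at ${\bf 0}$, $\mathcal{A}(B_{u_0})\times\{(x,0)\}\cup\mathcal{A}(B_{u_1})\times\{(x,1)\}$ at a decision node labelled $x$, $\mathcal{A}(B_{u_0})\times\mathcal{A}(B_{u_1})$ at a conjunction node, where $\times$ is union of pairs over disjoint domains; $B$ represents $\psi(G)$ if $\mathsf{var}(B)=V(G^*)$ and the assignments extending accepted ones are exactly the satisfying assignments of $\psi(G)$. $B$ is a $\wedge_d$-OBDD obeying $\pi^*$ if decision labels increase in $\pi^*$ along every path. Alignment $B[{\bf g}]$: delete, for each decision node labelled $x\in\mathsf{var}({\bf g})$, its out-edge labelled $1-{\bf g}(x)$, then delete nodes unreachable from the source. A decision node of $B[{\bf g}]$ is incomplete if it has one outgoing edge there, complete otherwise. $L({\bf g})$ is the set of complete decision nodes $w$ of $B[{\bf g}]$ reachable from the source via a path of $B[{\bf g}]$ on which all decision nodes other than $w$ are incomplete. $\mathcal{F}$ is the set of assignments ${\bf g}$ with domain $\pi_0$ such that at least one variable of $U[1]$ is mapped to $0$, at least two variables of $U[1]$ are mapped to $1$, and all variables of $\pi_0\setminus U[1]$ are mapped to $1$. $I({\bf g})=\{i:{\bf g}(u_i[1])=1\}$ and $W[2]_J=\{w_j[2]:j\in J\}$. -}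

module Defs where

open import Data.Nat using (ℕ; _<_; _≤_)
open import Data.Fin using (Fin)
import Data.Fin as Fin
open import Data.Product.Properties using (≡-dec)
open import Data.Bool using (Bool; true; false; _∨_)
open import Data.Maybe using (Maybe; just; nothing)
open import Data.Product using (Σ; ∃; ∃-syntax; _×_; _,_)
open import Data.Sum using (_⊎_)
open import Data.Empty using (⊥)
open import Relation.Nullary using (¬_; Dec; yes; no)
open import Relation.Binary.PropositionalEquality using (_≡_; _≢_; refl)
open import Function.Definitions using (Injective)

record Graph : Set₁ where
  field
    n     : ℕ
    Adj   : Fin n → Fin n → Set
    sym   : ∀ {u v} → Adj u v → Adj v u
    irrefl : ∀ {v} → ¬ Adj v v
open Graph public

NoIsolated : Graph → Set
NoIsolated G = ∀ (v : Fin (n G)) → ∃[ u ] Adj G v u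

data Copy : Set where
  c1 c2 : Copy

-- vertices of G* (= variables of ψ(G)); (v , c1) is v[1], (v , c2) is v[2]
VStar : Graph → Set
VStar G = Fin (n G) × Copy

data EdgeStar (G : Graph) : VStar G → VStar G → Set where
  e12 : ∀ {u v} → Adj G u v → EdgeStar G (u , c1) (v , c2)
  e21 : ∀ {u v} → Adj G u v → EdgeStar G (v , c2) (u , c1)

-- satisfaction of the CNF ψ(G) by a total assignment
SatPsi : (G : Graph) → (VStar G → Bool) → Set
SatPsi G σ =
  (∀ a b → EdgeStar G a b → (σ a ∨ σ b) ≡ true)
  × (∃[ v ] σ (v , c1) ≡ false)
  × (∃[ v ] σ (v , c2) ≡ false)

IsInducedMatching : (G : Graph) {q : ℕ} → (Fin q → VStar G × VStar G) → Set
IsInducedMatching G {q} M =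
  (∀ i → let (a , b) = M i in EdgeStar G a b)
  × (∀ i j → i ≢ j → let (a , b) = M i ; (c , d) = M j in
       a ≢ c × a ≢ d × b ≢ c × b ≢ d)
  × (∀ i j → i ≢ j → let (a , b) = M i ; (c , d) = M j in
       ¬ EdgeStar G a c × ¬ EdgeStar G a d × ¬ EdgeStar G b c × ¬ EdgeStar G b d)

-- Partial assignments (sets of pairs (x , b) with functional domain)

PAssign : Set → Set
PAssign X = X → Maybe Bool

∅a : ∀ {X} → PAssign X
∅a _ = nothing

_≟c_ : (a b : Copy) → Dec (a ≡ b)
c1 ≟c c1 = yes refl
c1 ≟c c2 = no (λ ())
c2 ≟c c1 = no (λ ())
c2 ≟c c2 = yes refl

_≟v_ : {G : Graph} (a b : VStar G) → Dec (a ≡ b)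
_≟v_ = ≡-dec Fin._≟_ _≟c_

extend : {G : Graph} → PAssign (VStar G) → VStar G → Bool → PAssign (VStar G)
extend {G} α x b y with _≟v_ {G} x y
... | yes _ = just b
... | no _  = α y

-- union of partial assignments (used on disjoint domains)
_∪a_ : ∀ {X} → PAssign X → PAssign X → PAssign X
(α ∪a β) y with α y
... | just b  = just b
... | nothing = β y

data Kind (X : Set) (m : ℕ) : Set where
  sink : Bool → Kind X m
  dec  : X → (lo hi : Fin m) → Kind X m
  conj : (l r : Fin m) → Kind X m

record Diagram (G : Graph) : Set where
  field
    m      : ℕ
    kind   : Fin m → Kind (VStar G) m
    source : Fin m
open Diagram public

module _ {G : Graph} (B : Diagram G) where

  Node : Set
  Node = Fin (m B)

  data Child : Node → Node → Set where
    ch0 : ∀ {u x lo hi} → kind B u ≡ dec x lo hi → Child u lo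
    ch1 : ∀ {u x lo hi} → kind B u ≡ dec x lo hi → Child u hi
    chl : ∀ {u l r} → kind B u ≡ conj l r → Child u l
    chr : ∀ {u l r} → kind B u ≡ conj l r → Child u r

  data Reach : Node → Node → Set where
    here : ∀ {u} → Reach u u
    step : ∀ {u v w} → Child u v → Reach v w → Reach u w

  SReach : Node → Node → Set
  SReach u w = ∃[ v ] (Child u v × Reach v w)

  InVar : Node → VStar G → Set
  InVar u x = ∃[ w ] (Reach u w × ∃[ lo ] ∃[ hi ] (kind B w ≡ dec x lo hi))

  IsFBDD : Set
  IsFBDD =
    (∀ u v → Child u v → ¬ Reach v u)
    × (∀ u → Reach (source B) u)
    × (∀ u v b → kind B u ≡ sink b → kind B v ≡ sink b → u ≡ v)
    × (∀ u l r → kind B u ≡ conj l r → ∀ x → ¬ (InVar l x × InVar r x))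
    × (∀ w w' x lo hi lo' hi' → kind B w ≡ dec x lo hi → kind B w' ≡ dec x lo' hi'
         → ¬ SReach w w')

  data Acc : Node → PAssign (VStar G) → Set where
    acc1  : ∀ {u} → kind B u ≡ sink true → Acc u ∅a
    acc0  : ∀ {u x lo hi α} → kind B u ≡ dec x lo hi → Acc lo α
            → Acc u (extend {G} α x false)
    accH  : ∀ {u x lo hi α} → kind B u ≡ dec x lo hi → Acc hi α
            → Acc u (extend {G} α x true)
    accC  : ∀ {u l r α β} → kind B u ≡ conj l r → Acc l α → Acc r β
            → Acc u (α ∪a β)

  Extends : (VStar G → Bool) → PAssign (VStar G) → Set
  Extends σ α = ∀ x b → α x ≡ just b → σ x ≡ b

  Represents : Set
  Represents =
    (∀ x → InVar (source B) x)
    × (∀ σ → (SatPsi G σ → ∃[ α ] (Acc (source B) α × Extends σ α))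
           × (∃[ α ] (Acc (source B) α × Extends σ α) → SatPsi G σ))

  Obeys : (VStar G → ℕ) → Set
  Obeys rank = ∀ w w' x y lo hi lo' hi' → kind B w ≡ dec x lo hi
               → kind B w' ≡ dec y lo' hi' → SReach w w' → rank x < rank y

  module _ (g : PAssign (VStar G)) where

    -- edges of B[g] (before removing unreachable nodes)
    data AChild : Node → Node → Set where
      ach0 : ∀ {u x lo hi} → kind B u ≡ dec x lo hi → g x ≢ just true  → AChild u lo
      ach1 : ∀ {u x lo hi} → kind B u ≡ dec x lo hi → g x ≢ just false → AChild u hi
      achl : ∀ {u l r} → kind B u ≡ conj l r → AChild u l
      achr : ∀ {u l r} → kind B u ≡ conj l r → AChild u r

    -- complete decision node (keeps both out-edges in B[g])
    Complete : Node → Set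
    Complete u = ∃[ x ] ∃[ lo ] ∃[ hi ] (kind B u ≡ dec x lo hi × g x ≡ nothing)

    data IncPath : Node → Node → Set where
      stop : ∀ {w} → IncPath w w
      go   : ∀ {u v w} → ¬ Complete u → AChild u v → IncPath v w → IncPath u w

    InL : Node → Set
    InL w = Complete w × IncPath (source B) w

-- The setting of the lemma: U = {u_1..u_q}, W = {w_1..w_q} given as
-- maps u w : Fin q → V(G); the linear order π* given by an injective rank.

module _ {G : Graph} {q : ℕ} (rank : VStar G → ℕ) (u : Fin q → Fin (n G)) where

  InPi0 : VStar G → Set
  InPi0 x = ∃[ i ] (rank x ≤ rank (u i , c1))

  InF : PAssign (VStar G) → Set
  InF g =
    (∀ x → (InPi0 x → ∃[ b ] (g x ≡ just b)) × (∀ b → g x ≡ just b → InPi0 x))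
    × (∃[ i ] (g (u i , c1) ≡ just false))
    × (∃[ i ] ∃[ j ] (i ≢ j × g (u i , c1) ≡ just true × g (u j , c1) ≡ just true))
    × (∀ x → InPi0 x → (∀ i → x ≢ (u i , c1)) → g x ≡ just true)

-- Let ρ complete g by 1 and let σ_k be ρ with w_k[2] flipped to 0.  Both
-- extend g, since W[2] lies after π₀.  ρ falsifies ⋁ ¬v[2], while for
-- k ∈ I(g) σ_k satisfies ψ(G) because M is induced.  Reading an accepting
-- run for σ_k in B[g], it can be copied into a run for ρ except at some node
-- of L(g) whose run mentions w_k[2]; that node is blamed for w_k[2].  Paths
-- of B[g] through incomplete nodes only branch at conjunction nodes, so
-- distinct nodes of L(g) have disjoint variables.  Fix a node c blamed for
-- w_a[2]: at every other node of L(g) the σ_a-run cannot mention w_a[2] and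
-- is already a ρ-run, so for each j ∈ I(g) the blame for w_j[2] falls on c.
module Submission where

open import Defs hiding (sym)
open import Data.Nat using (ℕ; _<_)
open import Data.Nat.Properties using (<-irrefl; ≤-<-trans)
open import Data.Fin using (Fin; _≟_)
open import Data.Fin.Properties using (any?)
open import Data.Bool using (Bool; true; false; _∨_)
open import Data.Bool.Properties using (∨-zeroʳ; ¬-not)
open import Data.Maybe using (just; nothing; fromMaybe)
open import Data.Maybe.Properties using (just-injective)
open import Data.Product using (_×_; _,_; ∃-syntax; proj₁; proj₂)
open import Data.Sum using (_⊎_; inj₁; inj₂; [_,_]′; map₁; map₂; swap)
open import Data.Empty using (⊥-elim)
open import Function using (id; case_of_)
open import Relation.Nullary using (¬_; yes; no)
open import Relation.Binary.PropositionalEquality using (_≡_; _≢_; refl; sym; trans; cong)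
open import Function.Definitions using (Injective)

∨-true : ∀ {x y} → x ≡ true ⊎ y ≡ true → (x ∨ y) ≡ true
∨-true (inj₁ refl) = refl
∨-true {x} (inj₂ refl) = ∨-zeroʳ x

∪a-left : ∀ {X} (α β : PAssign X) {y b} → α y ≡ just b → (α ∪a β) y ≡ just b
∪a-left α β {y} αy rewrite αy = refl

∪a-right : ∀ {X} (α β : PAssign X) {y} → α y ≡ nothing → (α ∪a β) y ≡ β y
∪a-right α β {y} αy rewrite αy = refl

fillTrue : ∀ {X} → PAssign X → X → Bool
fillTrue α x = fromMaybe true (α x)

module _ {G : Graph} where

  extend-self : ∀ (α : PAssign (VStar G)) x b → extend {G} α x b x ≡ just b
  extend-self α x b with _≟v_ {G} x x
  ... | yes _ = refl
  ... | no x≢x = ⊥-elim (x≢x refl)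

  extend-other : ∀ (α : PAssign (VStar G)) {x y} b → x ≢ y → extend {G} α x b y ≡ α y
  extend-other α {x} {y} b x≢y with _≟v_ {G} x y
  ... | yes x≡y = ⊥-elim (x≢y x≡y)
  ... | no _ = refl

module Diagrams {G : Graph} (B : Diagram G) (fb : IsFBDD B) where

  Accepts : Node B → (VStar G → Bool) → Set
  Accepts u σ = ∃[ α ] (Acc B u α × Extends B σ α)

  conj-disjoint : ∀ {u l r x} → kind B u ≡ conj l r → ¬ (InVar B l x × InVar B r x)
  conj-disjoint {u} {l} {r} {x} k = proj₁ (proj₂ (proj₂ (proj₂ fb))) u l r k x

  label-not-below : ∀ {u v x lo hi} → kind B u ≡ dec x lo hi → Child B u v → ¬ InVar B v x
  label-not-below {u} {v} {x} {lo} {hi} k ch (w , v↝w , lo' , hi' , k') =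
    proj₂ (proj₂ (proj₂ (proj₂ fb))) u w x lo hi lo' hi' k k' (v , ch , v↝w)

  reach-trans : ∀ {a b c} → Reach B a b → Reach B b c → Reach B a c
  reach-trans here b↝c = b↝c
  reach-trans (step ch a↝b) b↝c = step ch (reach-trans a↝b b↝c)

  reach-invar : ∀ {u v x} → Reach B u v → InVar B v x → InVar B u x
  reach-invar u↝v (w , v↝w , lo , hi , k) = w , reach-trans u↝v v↝w , lo , hi , k

  child-invar : ∀ {u v x} → Child B u v → InVar B v x → InVar B u x
  child-invar ch = reach-invar (step ch here)

  acc-dom⊆var : ∀ {u α x b} → Acc B u α → α x ≡ just b → InVar B u x
  acc-dom⊆var (acc1 k) ()
  acc-dom⊆var {u} {x = x} (acc0 {x = y} {lo} {hi} k D) αx with _≟v_ {G} y x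
  ... | yes refl = u , here , lo , hi , k
  ... | no _ = child-invar (ch0 k) (acc-dom⊆var D αx)
  acc-dom⊆var {u} {x = x} (accH {x = y} {lo} {hi} k D) αx with _≟v_ {G} y x
  ... | yes refl = u , here , lo , hi , k
  ... | no _ = child-invar (ch1 k) (acc-dom⊆var D αx)
  acc-dom⊆var {x = x} (accC {α = α} k Dl Dr) αβx with α x in αx
  ... | just _ = child-invar (chl k) (acc-dom⊆var Dl αx)
  ... | nothing = child-invar (chr k) (acc-dom⊆var Dr αβx)

  acc-outside-var : ∀ {u α x} → Acc B u α → ¬ InVar B u x → α x ≡ nothing
  acc-outside-var {α = α} {x} D x∉u with α x in αx
  ... | just _ = ⊥-elim (x∉u (acc-dom⊆var D αx))
  ... | nothing = refl

  extends-extend : ∀ {σ α x b} → Extends B σ α → σ x ≡ b → Extends B σ (extend {G} α x b)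
  extends-extend {x = x} E σx y c αy with _≟v_ {G} x y
  ... | yes refl = trans σx (just-injective αy)
  ... | no _ = E y c αy

  extends-extend⁻ : ∀ {σ α x b} → α x ≡ nothing → Extends B σ (extend {G} α x b) → Extends B σ α
  extends-extend⁻ {α = α} {x} {b} αx E y c αy with _≟v_ {G} x y
  ... | yes refl = case trans (sym αx) αy of λ ()
  ... | no x≢y = E y c (trans (extend-other α b x≢y) αy)

  extends-∪ : ∀ {σ α β} → Extends B σ α → Extends B σ β → Extends B σ (α ∪a β)
  extends-∪ {α = α} El Er y c αβy with α y in αy
  ... | just _ = El y c (trans αy αβy)
  ... | nothing = Er y c αβy

  extends-∪ˡ : ∀ {σ α β} → Extends B σ (α ∪a β) → Extends B σ α
  extends-∪ˡ {α = α} {β} E y c αy = E y c (∪a-left α β αy)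

  extends-∪ʳ : ∀ {σ u l r α β} → kind B u ≡ conj l r → Acc B l α → Acc B r β
             → Extends B σ (α ∪a β) → Extends B σ β
  extends-∪ʳ {α = α} {β} k Dl Dr E y c βy with α y in αy
  ... | just _ = ⊥-elim (conj-disjoint k (acc-dom⊆var Dl αy , acc-dom⊆var Dr βy))
  ... | nothing = E y c (trans (∪a-right α β αy) βy)

  fillTrue-extends : ∀ {α} → Extends B (fillTrue α) α
  fillTrue-extends y b αy rewrite αy = refl

  accepts-lo : ∀ {σ u x lo hi} → kind B u ≡ dec x lo hi → σ x ≡ false → Accepts u σ → Accepts lo σ
  accepts-lo k _ (_ , acc1 k' , _) with trans (sym k) k'
  ... | ()
  accepts-lo k _ (_ , acc0 k' D , E) with trans (sym k) k'
  ... | refl = _ , D , extends-extend⁻ (acc-outside-var D (label-not-below k (ch0 k))) E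
  accepts-lo {x = x} k σx (_ , accH {α = α} k' D , E) with trans (sym k) k'
  ... | refl with trans (sym σx) (E x true (extend-self α x true))
  ... | ()
  accepts-lo k _ (_ , accC k' _ _ , _) with trans (sym k) k'
  ... | ()

  accepts-hi : ∀ {σ u x lo hi} → kind B u ≡ dec x lo hi → σ x ≡ true → Accepts u σ → Accepts hi σ
  accepts-hi k _ (_ , acc1 k' , _) with trans (sym k) k'
  ... | ()
  accepts-hi {x = x} k σx (_ , acc0 {α = α} k' D , E) with trans (sym k) k'
  ... | refl with trans (sym σx) (E x false (extend-self α x false))
  ... | ()
  accepts-hi k _ (_ , accH k' D , E) with trans (sym k) k'
  ... | refl = _ , D , extends-extend⁻ (acc-outside-var D (label-not-below k (ch1 k))) E
  accepts-hi k _ (_ , accC k' _ _ , _) with trans (sym k) k'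
  ... | ()

  accepts-conj : ∀ {σ u l r} → kind B u ≡ conj l r → Accepts u σ → Accepts l σ × Accepts r σ
  accepts-conj k (_ , acc1 k' , _) with trans (sym k) k'
  ... | ()
  accepts-conj k (_ , acc0 k' _ , _) with trans (sym k) k'
  ... | ()
  accepts-conj k (_ , accH k' _ , _) with trans (sym k) k'
  ... | ()
  accepts-conj k (_ , accC k' Dl Dr , E) with trans (sym k) k'
  ... | refl = (_ , Dl , extends-∪ˡ E) , (_ , Dr , extends-∪ʳ k Dl Dr E)

  accepts-or-mentions : ∀ {σ ρ c x} → (∀ y → x ≢ y → σ y ≡ ρ y)
                      → Accepts c σ → Accepts c ρ ⊎ InVar B c x
  accepts-or-mentions {x = x} σ≈ρ (β , D , E) with β x in βx
  ... | just _ = inj₂ (acc-dom⊆var D βx)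
  ... | nothing = inj₁ (β , D , λ y c βy → trans (sym (σ≈ρ y (off-x βy))) (E y c βy))
    where
    off-x : ∀ {y c} → β y ≡ just c → x ≢ y
    off-x βy refl = case trans (sym βx) βy of λ ()

  module Alignment (g : PAssign (VStar G)) where

    Frontier : Node B → Node B → Set
    Frontier u c = Complete B g c × IncPath B g u c

    incomplete-assigned : ∀ {u x lo hi} → ¬ Complete B g u → kind B u ≡ dec x lo hi → ∃[ b ] g x ≡ just b
    incomplete-assigned {x = x} {lo} {hi} nc k with g x in gx
    ... | just b = b , refl
    ... | nothing = ⊥-elim (nc (x , lo , hi , k , gx))

    assigned-incomplete : ∀ {u x lo hi b} → kind B u ≡ dec x lo hi → g x ≡ just b → ¬ Complete B g u
    assigned-incomplete k gx (_ , _ , _ , k' , gx') with trans (sym k) k'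
    ... | refl = case trans (sym gx) gx' of λ ()

    conj-incomplete : ∀ {u l r} → kind B u ≡ conj l r → ¬ Complete B g u
    conj-incomplete k (_ , _ , _ , k' , _) with trans (sym k) k'
    ... | ()

    incomplete-label : ∀ {σ u x lo hi} → Extends B σ g → ¬ Complete B g u → kind B u ≡ dec x lo hi
                     → g x ≡ just (σ x)
    incomplete-label {x = x} eσ nc k with incomplete-assigned nc k
    ... | b , gx = trans gx (cong just (sym (eσ x b gx)))

    incPath-reach : ∀ {u c} → IncPath B g u c → Reach B u c
    incPath-reach stop = here
    incPath-reach (go _ (ach0 k _) p) = step (ch0 k) (incPath-reach p)
    incPath-reach (go _ (ach1 k _) p) = step (ch1 k) (incPath-reach p)
    incPath-reach (go _ (achl k) p) = step (chl k) (incPath-reach p)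
    incPath-reach (go _ (achr k) p) = step (chr k) (incPath-reach p)

    accepts-along : ∀ {σ u c} → Extends B σ g → IncPath B g u c → Accepts u σ → Accepts c σ
    accepts-along eσ stop a = a
    accepts-along eσ (go nc (ach0 k g≢t) p) a =
      accepts-along eσ p (accepts-lo k (¬-not λ σx → g≢t (trans (incomplete-label eσ nc k) (cong just σx))) a)
    accepts-along eσ (go nc (ach1 k g≢f) p) a =
      accepts-along eσ p (accepts-hi k (¬-not λ σx → g≢f (trans (incomplete-label eσ nc k) (cong just σx))) a)
    accepts-along eσ (go nc (achl k) p) a = accepts-along eσ p (proj₁ (accepts-conj k a))
    accepts-along eσ (go nc (achr k) p) a = accepts-along eσ p (proj₂ (accepts-conj k a))

    -- An incomplete decision node keeps a single out-edge, so two paths of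
    -- B[g] can only part ways at a conjunction node, below which they see
    -- disjoint variables.
    achild-split : ∀ {u v v'} → ¬ Complete B g u → AChild B g u v → AChild B g u v'
                 → v ≡ v' ⊎ (∀ {x} → ¬ (InVar B v x × InVar B v' x))
    achild-split _ (ach0 k _) (ach0 k' _) with trans (sym k) k'
    ... | refl = inj₁ refl
    achild-split _ (ach1 k _) (ach1 k' _) with trans (sym k) k'
    ... | refl = inj₁ refl
    achild-split nc (ach0 k g≢t) (ach1 k' g≢f) with trans (sym k) k' | incomplete-assigned nc k
    ... | refl | true , gx = ⊥-elim (g≢t gx)
    ... | refl | false , gx = ⊥-elim (g≢f gx)
    achild-split nc (ach1 k g≢f) (ach0 k' g≢t) with trans (sym k) k' | incomplete-assigned nc k
    ... | refl | true , gx = ⊥-elim (g≢t gx)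
    ... | refl | false , gx = ⊥-elim (g≢f gx)
    achild-split _ (achl k) (achl k') with trans (sym k) k'
    ... | refl = inj₁ refl
    achild-split _ (achr k) (achr k') with trans (sym k) k'
    ... | refl = inj₁ refl
    achild-split _ (achl k) (achr k') with trans (sym k) k'
    ... | refl = inj₂ (conj-disjoint k)
    achild-split _ (achr k) (achl k') with trans (sym k) k'
    ... | refl = inj₂ λ (i , i') → conj-disjoint k (i' , i)
    achild-split _ (ach0 k _) (achl k') with trans (sym k) k'
    ... | ()
    achild-split _ (ach0 k _) (achr k') with trans (sym k) k'
    ... | ()
    achild-split _ (ach1 k _) (achl k') with trans (sym k) k'
    ... | ()
    achild-split _ (ach1 k _) (achr k') with trans (sym k) k'
    ... | ()
    achild-split _ (achl k) (ach0 k' _) with trans (sym k) k'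
    ... | ()
    achild-split _ (achl k) (ach1 k' _) with trans (sym k) k'
    ... | ()
    achild-split _ (achr k) (ach0 k' _) with trans (sym k) k'
    ... | ()
    achild-split _ (achr k) (ach1 k' _) with trans (sym k) k'
    ... | ()

    frontier-unique : ∀ {s c c' x} → Frontier s c → Frontier s c' → InVar B c x → InVar B c' x → c ≡ c'
    frontier-unique {c = c} {c'} (cc , p) (cc' , p') x∈c x∈c' = meet p p'
      where
      meet : ∀ {s} → IncPath B g s c → IncPath B g s c' → c ≡ c'
      meet stop stop = refl
      meet stop (go nc _ _) = ⊥-elim (nc cc)
      meet (go nc _ _) stop = ⊥-elim (nc cc')
      meet (go nc a q) (go _ a' q') with achild-split nc a a'
      ... | inj₁ refl = meet q q'
      ... | inj₂ disjoint =
        ⊥-elim (disjoint (reach-invar (incPath-reach q) x∈c , reach-invar (incPath-reach q') x∈c'))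

    -- The run for σ drives the recursion; on incomplete nodes σ and ρ both
    -- agree with g, so it is copied for ρ down to the frontier.
    accepts-from-frontier : ∀ {σ ρ u} {R : Set} → Extends B σ g → Extends B ρ g → Accepts u σ
                          → (∀ c → Frontier u c → Accepts c ρ ⊎ R) → Accepts u ρ ⊎ R
    accepts-from-frontier {σ} {ρ} {R = R} eσ eρ (_ , D , E) = build D E
      where
      build : ∀ {u α} → Acc B u α → Extends B σ α → (∀ c → Frontier u c → Accepts c ρ ⊎ R)
            → Accepts u ρ ⊎ R
      build (acc1 k) _ _ = inj₁ (∅a , acc1 k , λ _ _ ())
      build (acc0 {u} {x} {lo} {hi} {α} k D) E oracle with g x in gx
      ... | nothing = oracle u ((x , lo , hi , k , gx) , stop)
      ... | just b with trans (sym (eσ x b gx)) (E x false (extend-self α x false))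
      ... | refl =
        map₁ (λ (β , D' , E') → extend {G} β x false , acc0 k D' , extends-extend E' (eρ x false gx))
             (build D (extends-extend⁻ (acc-outside-var D (label-not-below k (ch0 k))) E)
                    λ c (cc , p) → oracle c (cc , go (assigned-incomplete k gx)
                                                      (ach0 k λ gx' → case trans (sym gx) gx' of λ ()) p))
      build (accH {u} {x} {lo} {hi} {α} k D) E oracle with g x in gx
      ... | nothing = oracle u ((x , lo , hi , k , gx) , stop)
      ... | just b with trans (sym (eσ x b gx)) (E x true (extend-self α x true))
      ... | refl =
        map₁ (λ (β , D' , E') → extend {G} β x true , accH k D' , extends-extend E' (eρ x true gx))
             (build D (extends-extend⁻ (acc-outside-var D (label-not-below k (ch1 k))) E)
                    λ c (cc , p) → oracle c (cc , go (assigned-incomplete k gx)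
                                                      (ach1 k λ gx' → case trans (sym gx) gx' of λ ()) p))
      build (accC k Dl Dr) E oracle
        with build Dl (extends-∪ˡ E) (λ c (cc , p) → oracle c (cc , go (conj-incomplete k) (achl k) p))
           | build Dr (extends-∪ʳ k Dl Dr E) (λ c (cc , p) → oracle c (cc , go (conj-incomplete k) (achr k) p))
      ... | inj₁ (βl , Dl' , El) | inj₁ (βr , Dr' , Er) = inj₁ (βl ∪a βr , accC k Dl' Dr' , extends-∪ El Er)
      ... | inj₂ r | _ = inj₂ r
      ... | inj₁ _ | inj₂ r = inj₂ r

    frontier-blames : ∀ {σ ρ u} {R : Set} → Extends B σ g → Extends B ρ g → Accepts u σ → ¬ Accepts u ρ
                    → (∀ c → Frontier u c → Accepts c ρ ⊎ R) → R
    frontier-blames eσ eρ a ¬a oracle = [ (λ a' → ⊥-elim (¬a a')) , id ]′ (accepts-from-frontier eσ eρ a oracle)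

module Main {G : Graph} (B : Diagram G) (fb : IsFBDD B) (rep : Represents B)
  (rank : VStar G → ℕ) {q : ℕ} (u w : Fin q → Fin (n G))
  (matching : IsInducedMatching G (λ i → ((u i , c1) , (w i , c2))))
  (U<W : ∀ i j → rank (u i , c1) < rank (w j , c2))
  (g : PAssign (VStar G)) (g∈F : InF {G} rank u g) where

  open Diagrams B fb
  open Alignment g

  assigned-in-π₀ : ∀ {x b} → g x ≡ just b → InPi0 {G} rank u x
  assigned-in-π₀ {x} = proj₂ (proj₁ g∈F x) _

  assigned-off-U-true : ∀ {x b} → g x ≡ just b → (∀ i → x ≢ (u i , c1)) → b ≡ true
  assigned-off-U-true {x} gx x∉U =
    just-injective (trans (sym gx) (proj₂ (proj₂ (proj₂ g∈F)) x (assigned-in-π₀ gx) x∉U))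

  W-unassigned : ∀ {k b} → g (w k , c2) ≢ just b
  W-unassigned {k} gw with assigned-in-π₀ gw
  ... | i , w≤u = <-irrefl refl (≤-<-trans w≤u (U<W i k))

  ρ : VStar G → Bool
  ρ = fillTrue g

  σ : Fin q → VStar G → Bool
  σ k = fillTrue (extend {G} g (w k , c2) false)

  ρ-extends : Extends B ρ g
  ρ-extends = fillTrue-extends

  ρ-V2 : ∀ v → ρ (v , c2) ≡ true
  ρ-V2 v with g (v , c2) in gv
  ... | nothing = refl
  ... | just b = assigned-off-U-true gv λ _ ()

  ρ-rejected : ¬ Accepts (source B) ρ
  ρ-rejected a with proj₂ (proj₂ (proj₂ (proj₂ rep ρ) a))
  ... | v , ρv with trans (sym (ρ-V2 v)) ρv
  ... | ()

  σ-agrees : ∀ k y → (w k , c2) ≢ y → σ k y ≡ ρ y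
  σ-agrees k y w≢y = cong (fromMaybe true) (extend-other g false w≢y)

  σ-extends : ∀ k → Extends B (σ k) g
  σ-extends k y b gy = trans (σ-agrees k y λ { refl → W-unassigned gy }) (ρ-extends y b gy)

  module _ (k : Fin q) (uk-true : g (u k , c1) ≡ just true) where

    ρ-neighbour : ∀ p → EdgeStar G (p , c1) (w k , c2) → ρ (p , c1) ≡ true
    ρ-neighbour p edge with g (p , c1) in gp
    ... | nothing = refl
    ... | just true = refl
    ... | just false with any? (λ i → p ≟ u i)
    ... | no p∉U = assigned-off-U-true gp λ i eq → p∉U (i , cong proj₁ eq)
    ... | yes (i , refl) with i ≟ k
    ... | yes refl = case trans (sym gp) uk-true of λ ()
    ... | no i≢k = ⊥-elim (proj₁ (proj₂ (proj₂ (proj₂ matching) i k i≢k)) edge)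

    covered : ∀ {p v} → Adj G p v → σ k (p , c1) ≡ true ⊎ σ k (v , c2) ≡ true
    covered {p} {v} adj with v ≟ w k
    ... | yes refl = inj₁ (trans (σ-agrees k _ λ ()) (ρ-neighbour p (e12 adj)))
    ... | no v≢w = inj₂ (trans (σ-agrees k _ λ eq → v≢w (sym (cong proj₁ eq))) (ρ-V2 v))

    σ-satisfies : SatPsi G (σ k)
    σ-satisfies = edges , (u i₀ , σ-u₀) , (w k , cong (fromMaybe true) (extend-self g (w k , c2) false))
      where
      edges : ∀ a b → EdgeStar G a b → (σ k a ∨ σ k b) ≡ true
      edges _ _ (e12 adj) = ∨-true (covered adj)
      edges _ _ (e21 adj) = ∨-true (swap (covered adj))
      i₀ = proj₁ (proj₁ (proj₂ g∈F))
      σ-u₀ : σ k (u i₀ , c1) ≡ false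
      σ-u₀ = trans (σ-agrees k _ λ ()) (cong (fromMaybe true) (proj₂ (proj₁ (proj₂ g∈F))))

    σ-accepted : Accepts (source B) (σ k)
    σ-accepted = proj₁ (proj₂ rep (σ k)) σ-satisfies

    frontier-accepts-ρ-or-mentions : ∀ {c} → Frontier (source B) c → Accepts c ρ ⊎ InVar B c (w k , c2)
    frontier-accepts-ρ-or-mentions (_ , p) =
      accepts-or-mentions (σ-agrees k) (accepts-along (σ-extends k) p σ-accepted)

    frontier-mentions : ∃[ c ] (InL B g c × InVar B c (w k , c2))
    frontier-mentions = frontier-blames (σ-extends k) ρ-extends σ-accepted ρ-rejected
      λ c c∈L → map₂ (λ m → c , c∈L , m) (frontier-accepts-ρ-or-mentions c∈L)

  frontier-mentions-all : ∀ {a c} (ua-true : g (u a , c1) ≡ just true) → InL B g c → InVar B c (w a , c2)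
                        → ∀ j → g (u j , c1) ≡ just true → InVar B c (w j , c2)
  frontier-mentions-all {a} {c} ua-true c∈L wa∈c j uj-true =
    frontier-blames (σ-extends j) ρ-extends (σ-accepted j uj-true) ρ-rejected oracle
    where
    oracle : ∀ c' → Frontier (source B) c' → Accepts c' ρ ⊎ InVar B c (w j , c2)
    oracle c' c'∈L with c' ≟ c
    ... | yes refl = frontier-accepts-ρ-or-mentions j uj-true c'∈L
    ... | no c'≢c = map₂ (λ wa∈c' → ⊥-elim (c'≢c (frontier-unique c'∈L c∈L wa∈c' wa∈c)))
                         (frontier-accepts-ρ-or-mentions a ua-true c'∈L)

lemma9 : (G : Graph) → NoIsolated G
    → (B : Diagram G) → IsFBDD B → Represents B
    → (rank : VStar G → ℕ) → Injective _≡_ _≡_ rank → Obeys B rank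
    → (q : ℕ) (u w : Fin q → Fin (n G))
    → IsInducedMatching G (λ i → ((u i , c1) , (w i , c2)))
    → (∀ i j → rank (u i , c1) < rank (w j , c2))
    → ∀ g → InF {G} rank u g
    → ∃[ v ] (InL B g v × (∀ j → g (u j , c1) ≡ just true → InVar B v (w j , c2)))
lemma9 G _ B fb rep rank _ _ q u w matching U<W g g∈F =
  let open Main B fb rep rank u w matching U<W g g∈F
      (a , _ , _ , ua-true , _) = proj₁ (proj₂ (proj₂ g∈F))
      (c , c∈L , wa∈c) = frontier-mentions a ua-true
  in c , c∈L , frontier-mentions-all ua-true c∈L wa∈c
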